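{- Let $\mathbf{A}$ be a finitely subdirectly irreducible De Morgan monoid that is not idempotent, and let $G$ be a deductive filter of $\mathbf{A}$ with $\neg(f^2)\in G$. Then $\mathbf{A}/G$ is an odd Sugihara monoid.
   Context: An involutive (commutative) residuated lattice (IRL) is an algebra $\langle A;\cdot,\wedge,\vee,\neg,e\rangle$ such that $\langle A;\cdot,e\rangle$ is a commutative monoid, $\langle A;\wedge,\vee\rangle$ is a lattice with order $\leqslant$, $\neg\neg x=x$, and $x\cdot y\leqslant z\iff \neg z\cdot y\leqslant\neg x$. Write $f:=\neg e$, $x\to y:=\neg(x\cdot\neg y)$, $x^2:=x\cdot x$. A De Morgan monoid is an IRL with distributive lattice reduct satisfying $x\leqslant x^2$; a Sugihara monoid is a De Morgan monoid satisfying $x^2=x$; an IRL is odd if $f=e$. An algebra is idempotent if $x^2=x$ for all its elements. An algebra is finitely subdirectly irreducible if its identity relation is meet-irreducible in its congruence lattice. A deductive filter of $\mathbf{A}$ is a lattice filter of $\langle A;\wedge,\vee\rangle$ that is also a submonoid of $\langle A;\cdot,e\rangle$; $\mathbf{A}/G$ denotes the quotient of $\mathbf{A}$ by the congruence $\{\langle a,b\rangle\in A^2: a\to b\in G \text{ and } b\to a\in G\}$. -}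

module Defs where

open import Level using (0ℓ)
open import Data.Product using (_×_; _,_)
open import Data.Sum using (_⊎_)
open import Relation.Nullary using (¬_)
open import Relation.Binary.Core using (Rel)
open import Relation.Binary.Structures using (IsEquivalence)
open import Algebra.Core using (Op₁; Op₂)
open import Algebra.Structures using (IsCommutativeMonoid)
open import Algebra.Lattice.Structures using (IsLattice; IsDistributiveLattice)

-- The signature ⟨A; ·, ∧, ∨, ¬, e⟩ of an IRL, over a carrier equipped with a
-- relation _≈_ playing the role of equality (setoid-style, since Agda has no
-- quotient types).  Quotients A/G are then obtained by keeping the carrier and
-- operations and replacing _≈_ by the congruence determined by G.
record Ops : Set₁ where
  field
    Carrier : Set
    _≈_     : Rel Carrier 0ℓ
    _·_     : Op₂ Carrier
    _∧_     : Op₂ Carrier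
    _∨_     : Op₂ Carrier
    ∼       : Op₁ Carrier
    e       : Carrier

  infix  4 _≈_ _≤_
  infixl 7 _·_
  infixr 6 _∧_
  infixr 5 _∨_
  infixr 4 _⇒_

  _≤_ : Rel Carrier 0ℓ
  x ≤ y = (x ∧ y) ≈ x

  f : Carrier
  f = ∼ e

  _⇒_ : Op₂ Carrier
  x ⇒ y = ∼ (x · ∼ y)

  _² : Op₁ Carrier
  x ² = x · x

record IsIRL (A : Ops) : Set where
  open Ops A
  field
    ·-isCommutativeMonoid : IsCommutativeMonoid _≈_ _·_ e
    isLattice             : IsLattice _≈_ _∨_ _∧_
    ∼-cong                : ∀ {x y} → x ≈ y → ∼ x ≈ ∼ y
    ∼-involutive          : ∀ x → ∼ (∼ x) ≈ x
    residuation₁          : ∀ x y z → x · y ≤ z → ∼ z · y ≤ ∼ x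
    residuation₂          : ∀ x y z → ∼ z · y ≤ ∼ x → x · y ≤ z

record IsDeMorganMonoid (A : Ops) : Set where
  open Ops A
  field
    isIRL                 : IsIRL A
    isDistributiveLattice : IsDistributiveLattice _≈_ _∨_ _∧_
    square-increasing     : ∀ x → x ≤ x ²

record IsSugiharaMonoid (A : Ops) : Set where
  open Ops A
  field
    isDeMorganMonoid : IsDeMorganMonoid A
    idempotent       : ∀ x → x ² ≈ x

IsOdd : Ops → Set
IsOdd A = f ≈ e
  where open Ops A

record IsOddSugiharaMonoid (A : Ops) : Set where
  field
    isSugiharaMonoid : IsSugiharaMonoid A
    odd              : IsOdd A

Idempotent : Ops → Set
Idempotent A = ∀ x → x ² ≈ x
  where open Ops A

record IsCongruence (A : Ops) (θ : Rel (Ops.Carrier A) 0ℓ) : Set where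
  open Ops A
  field
    isEquivalence : IsEquivalence θ
    ≈⊆θ           : ∀ {x y} → x ≈ y → θ x y
    ·-compat      : ∀ {x y u v} → θ x y → θ u v → θ (x · u) (y · v)
    ∧-compat      : ∀ {x y u v} → θ x y → θ u v → θ (x ∧ u) (y ∧ v)
    ∨-compat      : ∀ {x y u v} → θ x y → θ u v → θ (x ∨ u) (y ∨ v)
    ∼-compat      : ∀ {x y} → θ x y → θ (∼ x) (∼ y)

IsIdentity : (A : Ops) → Rel (Ops.Carrier A) 0ℓ → Set
IsIdentity A θ = ∀ x y → θ x y → x ≈ y
  where open Ops A

FinitelySubdirectlyIrreducible : Ops → Set₁
FinitelySubdirectlyIrreducible A =
  ∀ (θ φ : Rel (Ops.Carrier A) 0ℓ) → IsCongruence A θ → IsCongruence A φ →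
  IsIdentity A (λ x y → θ x y × φ x y) → IsIdentity A θ ⊎ IsIdentity A φ

record IsDeductiveFilter (A : Ops) (G : Ops.Carrier A → Set) : Set where
  open Ops A
  field
    up-closed : ∀ {x y} → x ≤ y → G x → G y
    ∧-closed  : ∀ {x y} → G x → G y → G (x ∧ y)
    e∈G       : G e
    ·-closed  : ∀ {x y} → G x → G y → G (x · y)

_/_ : (A : Ops) → (Ops.Carrier A → Set) → Ops
A / G = record
  { Carrier = Carrier
  ; _≈_     = λ a b → G (a ⇒ b) × G (b ⇒ a)
  ; _·_     = _·_
  ; _∧_     = _∧_
  ; _∨_     = _∨_
  ; ∼       = ∼
  ; e       = e
  }
  where open Ops A

-- So ¬(f²) ∈ G makes A/G idempotent, and if also e ≤ f² then f ≡ e in A/G.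
--  * The principal filters ↑(e ∧ f²) and ↑(e ∧ ¬(f²)) give congruences with
--    trivial intersection; finite subdirect irreducibility forces one of them
--    to be trivial, i.e. e ≤ f² or e ≤ ¬(f²), and the latter makes A idempotent.
module Submission where

open import Defs
open import Relation.Nullary using (¬_)
open import Level using (0ℓ)
open import Data.Product using (_×_; _,_; proj₁; proj₂)
open import Data.Sum using ([_,_]′)
open import Data.Empty using (⊥-elim)
open import Relation.Binary.Structures using (IsEquivalence; IsPartialOrder)
open import Algebra.Structures using (IsCommutativeMonoid)
open import Algebra.Lattice.Structures using (IsLattice; IsDistributiveLattice)
open import Algebra.Lattice.Bundles using (Lattice)
import Algebra.Lattice.Properties.Lattice as LatticeProperties
import Relation.Binary.Lattice as OrderLattice
import Relation.Binary.Reasoning.Setoid as SetoidReasoning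

module IRLProperties (A : Ops) (irl : IsIRL A) where
  open Ops A
  open IsIRL irl
  open IsCommutativeMonoid ·-isCommutativeMonoid
    using (isEquivalence; assoc; comm; identityˡ; identityʳ; ∙-cong; setoid)
  open IsEquivalence isEquivalence

  -- The library's lattice order is x ≈ x ∧ y; ours is x ∧ y ≈ x.
  private
    lattice : Lattice 0ℓ 0ℓ
    lattice = record { isLattice = isLattice }
    module OL = OrderLattice.IsLattice
      (LatticeProperties.∨-∧-isOrderTheoreticLattice lattice)
    module PO = IsPartialOrder OL.isPartialOrder

  ≤-refl : ∀ {x} → x ≤ x
  ≤-refl = sym PO.refl

  ≤-reflexive : ∀ {x y} → x ≈ y → x ≤ y
  ≤-reflexive p = sym (PO.reflexive p)

  ≤-trans : ∀ {x y z} → x ≤ y → y ≤ z → x ≤ z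
  ≤-trans p q = sym (PO.trans (sym p) (sym q))

  ≤-antisym : ∀ {x y} → x ≤ y → y ≤ x → x ≈ y
  ≤-antisym p q = PO.antisym (sym p) (sym q)

  ≤-resp : ∀ {x x' y y'} → x ≈ x' → y ≈ y' → x ≤ y → x' ≤ y'
  ≤-resp p q r = ≤-trans (≤-reflexive (sym p)) (≤-trans r (≤-reflexive q))

  ∧-lb₁ : ∀ {x y} → x ∧ y ≤ x
  ∧-lb₁ {x} {y} = sym (proj₁ (OL.infimum x y))

  ∧-lb₂ : ∀ {x y} → x ∧ y ≤ y
  ∧-lb₂ {x} {y} = sym (proj₁ (proj₂ (OL.infimum x y)))

  ∧-glb : ∀ {x y z} → z ≤ x → z ≤ y → z ≤ x ∧ y
  ∧-glb {x} {y} {z} p q = sym (proj₂ (proj₂ (OL.infimum x y)) z (sym p) (sym q))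

  ∨-ub₁ : ∀ {x y} → x ≤ x ∨ y
  ∨-ub₁ {x} {y} = sym (proj₁ (OL.supremum x y))

  ∨-ub₂ : ∀ {x y} → y ≤ x ∨ y
  ∨-ub₂ {x} {y} = sym (proj₁ (proj₂ (OL.supremum x y)))

  ∨-lub : ∀ {x y z} → x ≤ z → y ≤ z → x ∨ y ≤ z
  ∨-lub {x} {y} {z} p q = sym (proj₂ (proj₂ (OL.supremum x y)) z (sym p) (sym q))

  -- Negation reverses the order (residuation with y = e).
  ∼-antitone : ∀ {x y} → x ≤ y → ∼ y ≤ ∼ x
  ∼-antitone {x} {y} p = ≤-resp (identityʳ (∼ y)) refl
    (residuation₁ x e y (≤-resp (sym (identityʳ x)) refl p))

  ∼-reflect : ∀ {x y} → ∼ x ≤ ∼ y → y ≤ x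
  ∼-reflect p = ≤-resp (∼-involutive _) (∼-involutive _) (∼-antitone p)

  -- Multiplication is monotone (residuation combined with antitonicity of ¬).
  ·-monoˡ : ∀ {x y z} → x ≤ y → x · z ≤ y · z
  ·-monoˡ {x} {y} {z} p = residuation₂ x z (y · z)
    (≤-trans (residuation₁ y z (y · z) ≤-refl) (∼-antitone p))

  ·-monoʳ : ∀ {x y z} → x ≤ y → z · x ≤ z · y
  ·-monoʳ {x} {y} {z} p = ≤-resp (comm x z) (comm y z) (·-monoˡ p)

  ·-mono : ∀ {x y u v} → x ≤ y → u ≤ v → x · u ≤ y · v
  ·-mono p q = ≤-trans (·-monoˡ p) (·-monoʳ q)

  curry : ∀ {x y z} → x · y ≤ z → x ≤ (y ⇒ z)
  curry {x} {y} {z} p =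
    ≤-resp (∼-involutive x) (∼-cong (comm (∼ z) y)) (∼-antitone (residuation₁ x y z p))

  uncurry : ∀ {x y z} → x ≤ (y ⇒ z) → x · y ≤ z
  uncurry {x} {y} {z} p =
    residuation₂ x y z (≤-resp (trans (∼-involutive _) (comm y (∼ z))) refl (∼-antitone p))

  modus-ponens : ∀ {x y} → (x ⇒ y) · x ≤ y
  modus-ponens = uncurry ≤-refl

  e≤⇒ : ∀ {x y} → x ≤ y → e ≤ (x ⇒ y)
  e≤⇒ {x} p = curry (≤-resp (sym (identityˡ x)) refl p)

  e≤⇒-elim : ∀ {x y} → e ≤ (x ⇒ y) → x ≤ y
  e≤⇒-elim {x} p = ≤-resp (identityˡ x) refl (uncurry p)

  ⇒-cong : ∀ {x x' y y'} → x ≈ x' → y ≈ y' → (x ⇒ y) ≈ (x' ⇒ y')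
  ⇒-cong p q = ∼-cong (∙-cong p (∼-cong q))

  ⇒-monoʳ : ∀ {x y y'} → y ≤ y' → (x ⇒ y) ≤ (x ⇒ y')
  ⇒-monoʳ p = curry (≤-trans modus-ponens p)

  ⇒-compose : ∀ {x y z} → (x ⇒ y) · (y ⇒ z) ≤ (x ⇒ z)
  ⇒-compose {x} {y} {z} =
    curry (≤-trans (≤-reflexive regroup) (≤-trans (·-monoʳ modus-ponens) modus-ponens))
    where
    regroup : ((x ⇒ y) · (y ⇒ z)) · x ≈ (y ⇒ z) · ((x ⇒ y) · x)
    regroup = trans (∙-cong (comm _ _) refl) (assoc _ _ _)

  ⇒-·-compat : ∀ {x y u} → (x ⇒ y) ≤ ((x · u) ⇒ (y · u))
  ⇒-·-compat {x} {y} {u} =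
    curry (≤-trans (≤-reflexive (sym (assoc _ x u))) (·-monoˡ modus-ponens))

  ⇒-contrapose : ∀ {x y} → (x ⇒ y) ≈ (∼ y ⇒ ∼ x)
  ⇒-contrapose {x} {y} =
    ∼-cong (trans (comm x (∼ y)) (∙-cong refl (sym (∼-involutive x))))

  ⇒-residual-swap : ∀ x y z → ((x · y) ⇒ z) ≈ ((∼ z · y) ⇒ ∼ x)
  ⇒-residual-swap x y z = ∼-cong (begin
    (x · y) · ∼ z      ≈⟨ comm (x · y) (∼ z) ⟩
    ∼ z · (x · y)      ≈⟨ ∙-cong refl (comm x y) ⟩
    ∼ z · (y · x)      ≈⟨ sym (assoc (∼ z) y x) ⟩
    (∼ z · y) · x      ≈⟨ ∙-cong refl (sym (∼-involutive x)) ⟩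
    (∼ z · y) · ∼ (∼ x) ∎)
    where open SetoidReasoning setoid

  ∼-∧ : ∀ {a b} → ∼ (a ∧ b) ≈ ∼ a ∨ ∼ b
  ∼-∧ {a} {b} = ≤-antisym
    (∼-reflect (≤-resp refl (sym (∼-involutive _))
      (∧-glb (≤-resp refl (∼-involutive a) (∼-antitone ∨-ub₁))
             (≤-resp refl (∼-involutive b) (∼-antitone ∨-ub₂)))))
    (∨-lub (∼-antitone ∧-lb₁) (∼-antitone ∧-lb₂))

  ∨-via-∧ : ∀ {x u} → ∼ (∼ x ∧ ∼ u) ≈ x ∨ u
  ∨-via-∧ = trans ∼-∧ (IsLattice.∨-cong isLattice (∼-involutive _) (∼-involutive _))

  x·∼x≤f : ∀ {x} → x · ∼ x ≤ f
  x·∼x≤f {x} = residuation₂ x (∼ x) (∼ e)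
    (≤-reflexive (trans (∙-cong (∼-involutive e) refl) (identityˡ (∼ x))))

  ·∼≤f-elim : ∀ {a b} → a · ∼ b ≤ f → a ≤ b
  ·∼≤f-elim {a} {b} p = ≤-resp refl ∼b⇒f≈b (curry p)
    where
    ∼b⇒f≈b : (∼ b ⇒ f) ≈ b
    ∼b⇒f≈b = trans (∼-cong (trans (∙-cong refl (∼-involutive e)) (identityʳ (∼ b))))
                   (∼-involutive b)

  ·-interchange : ∀ {x y} → (x · x) · (y · y) ≈ (x · y) · (x · y)
  ·-interchange {x} {y} = begin
    (x · x) · (y · y) ≈⟨ assoc x x (y · y) ⟩
    x · (x · (y · y)) ≈⟨ ∙-cong refl (sym (assoc x y y)) ⟩
    x · ((x · y) · y) ≈⟨ ∙-cong refl (comm (x · y) y) ⟩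
    x · (y · (x · y)) ≈⟨ sym (assoc x y (x · y)) ⟩
    (x · y) · (x · y) ∎
    where open SetoidReasoning setoid

module FilterQuotient (A : Ops) (irl : IsIRL A) (G : Ops.Carrier A → Set)
                      (filter : IsDeductiveFilter A G) where
  open Ops A
  open IsIRL irl
  open IsCommutativeMonoid ·-isCommutativeMonoid
    using (isEquivalence; assoc; comm; identityˡ; identityʳ)
  open IsEquivalence isEquivalence
  open IRLProperties A irl
  open IsDeductiveFilter filter
  module L = IsLattice isLattice

  θ : Carrier → Carrier → Set
  θ = Ops._≈_ (A / G)

  G-resp : ∀ {x y} → x ≈ y → G x → G y
  G-resp p = up-closed (≤-reflexive p)

  ≤⇒G : ∀ {x y} → x ≤ y → G (x ⇒ y)
  ≤⇒G p = up-closed (e≤⇒ p) e∈G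

  G-compose : ∀ {x y z} → G (x ⇒ y) → G (y ⇒ z) → G (x ⇒ z)
  G-compose p q = up-closed ⇒-compose (·-closed p q)

  θ-isEquivalence : IsEquivalence θ
  θ-isEquivalence = record
    { refl  = ≤⇒G ≤-refl , ≤⇒G ≤-refl
    ; sym   = λ { (p , q) → q , p }
    ; trans = λ { (p , q) (p' , q') → G-compose p p' , G-compose q' q }
    }

  θ-trans : ∀ {x y z} → θ x y → θ y z → θ x z
  θ-trans = IsEquivalence.trans θ-isEquivalence

  ≈⇒θ : ∀ {x y} → x ≈ y → θ x y
  ≈⇒θ p = ≤⇒G (≤-reflexive p) , ≤⇒G (≤-reflexive (sym p))

  -- Compatibility is proved one argument at a time; commutativity of · and ∧
  -- transfers it to the other argument.
  G-·-compat : ∀ {x y u} → G (x ⇒ y) → G ((x · u) ⇒ (y · u))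
  G-·-compat = up-closed ⇒-·-compat

  G-∧-compat : ∀ {x y u} → G (x ⇒ y) → G ((x ∧ u) ⇒ (y ∧ u))
  G-∧-compat {x} {y} {u} p = up-closed (curry (∧-glb
      (≤-trans (·-mono ∧-lb₁ ∧-lb₁) modus-ponens)
      (≤-trans (·-mono ∧-lb₂ ∧-lb₂) (≤-reflexive (identityˡ u)))))
    (∧-closed p e∈G)

  θ-·-compat : ∀ {x y u v} → θ x y → θ u v → θ (x · u) (y · v)
  θ-·-compat (p , q) (p' , q') = θ-trans (G-·-compat p , G-·-compat q)
    ( G-resp (⇒-cong (comm _ _) (comm _ _)) (G-·-compat p')
    , G-resp (⇒-cong (comm _ _) (comm _ _)) (G-·-compat q'))

  θ-∧-compat : ∀ {x y u v} → θ x y → θ u v → θ (x ∧ u) (y ∧ v)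
  θ-∧-compat (p , q) (p' , q') = θ-trans (G-∧-compat p , G-∧-compat q)
    ( G-resp (⇒-cong (L.∧-comm _ _) (L.∧-comm _ _)) (G-∧-compat p')
    , G-resp (⇒-cong (L.∧-comm _ _) (L.∧-comm _ _)) (G-∧-compat q'))

  θ-∼-compat : ∀ {x y} → θ x y → θ (∼ x) (∼ y)
  θ-∼-compat (p , q) = G-resp ⇒-contrapose q , G-resp ⇒-contrapose p

  θ-∨-compat : ∀ {x y u v} → θ x y → θ u v → θ (x ∨ u) (y ∨ v)
  θ-∨-compat p q = θ-trans (≈⇒θ (sym ∨-via-∧))
    (θ-trans (θ-∼-compat (θ-∧-compat (θ-∼-compat p) (θ-∼-compat q))) (≈⇒θ ∨-via-∧))

  θ-isCongruence : IsCongruence A θ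
  θ-isCongruence = record
    { isEquivalence = θ-isEquivalence
    ; ≈⊆θ           = ≈⇒θ
    ; ·-compat      = θ-·-compat
    ; ∧-compat      = θ-∧-compat
    ; ∨-compat      = θ-∨-compat
    ; ∼-compat      = θ-∼-compat
    }

  ≤/-elim : ∀ {x z} → Ops._≤_ (A / G) x z → G (x ⇒ z)
  ≤/-elim (_ , q) = up-closed (⇒-monoʳ ∧-lb₂) q

  ≤/-intro : ∀ {x z} → G (x ⇒ z) → Ops._≤_ (A / G) x z
  ≤/-intro {x} {z} p = ≤⇒G ∧-lb₁ ,
    up-closed (curry (∧-glb (≤-trans (·-monoˡ ∧-lb₁) (≤-reflexive (identityˡ x)))
                            (≤-trans (·-monoˡ ∧-lb₂) modus-ponens)))
      (∧-closed e∈G p)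

  quotient-isLattice : IsLattice θ _∨_ _∧_
  quotient-isLattice = record
    { isEquivalence = θ-isEquivalence
    ; ∨-comm        = λ x y → ≈⇒θ (L.∨-comm x y)
    ; ∨-assoc       = λ x y z → ≈⇒θ (L.∨-assoc x y z)
    ; ∨-cong        = θ-∨-compat
    ; ∧-comm        = λ x y → ≈⇒θ (L.∧-comm x y)
    ; ∧-assoc       = λ x y z → ≈⇒θ (L.∧-assoc x y z)
    ; ∧-cong        = θ-∧-compat
    ; absorptive    = (λ x y → ≈⇒θ (L.∨-absorbs-∧ x y))
                    , (λ x y → ≈⇒θ (L.∧-absorbs-∨ x y))
    }

  -- A/G is an IRL: the equational axioms hold already in A, and both
  -- residuation laws say that the same implication lies in G.
  quotient-isIRL : IsIRL (A / G)
  quotient-isIRL = record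
    { ·-isCommutativeMonoid = record
      { isMonoid = record
        { isSemigroup = record
          { isMagma = record { isEquivalence = θ-isEquivalence ; ∙-cong = θ-·-compat }
          ; assoc   = λ x y z → ≈⇒θ (assoc x y z) }
        ; identity = (λ x → ≈⇒θ (identityˡ x)) , (λ x → ≈⇒θ (identityʳ x)) }
      ; comm = λ x y → ≈⇒θ (comm x y) }
    ; isLattice    = quotient-isLattice
    ; ∼-cong       = θ-∼-compat
    ; ∼-involutive = λ x → ≈⇒θ (∼-involutive x)
    ; residuation₁ = λ x y z p → ≤/-intro (G-resp (⇒-residual-swap x y z) (≤/-elim p))
    ; residuation₂ = λ x y z p → ≤/-intro (G-resp (sym (⇒-residual-swap x y z)) (≤/-elim p))
    }

  quotient-isDistributiveLattice :
    IsDistributiveLattice _≈_ _∨_ _∧_ → IsDistributiveLattice θ _∨_ _∧_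
  quotient-isDistributiveLattice dist = record
    { isLattice   = quotient-isLattice
    ; ∨-distrib-∧ = (λ x y z → ≈⇒θ (D.∨-distribˡ-∧ x y z))
                  , (λ x y z → ≈⇒θ (D.∨-distribʳ-∧ x y z))
    ; ∧-distrib-∨ = (λ x y z → ≈⇒θ (D.∧-distribˡ-∨ x y z))
                  , (λ x y z → ≈⇒θ (D.∧-distribʳ-∨ x y z))
    }
    where module D = IsDistributiveLattice dist

module DeMorganProperties (A : Ops) (dm : IsDeMorganMonoid A) where
  open Ops A
  open IsDeMorganMonoid dm
  open IsIRL isIRL
  open IsCommutativeMonoid ·-isCommutativeMonoid using (isEquivalence; identityˡ; identityʳ)
  open IsEquivalence isEquivalence
  open IRLProperties A isIRL
  module D = IsDistributiveLattice isDistributiveLattice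

  -- x²·¬x ≤ x²·(¬x)² = (x·¬x)² ≤ f².
  square·∼≤f² : ∀ {x} → x ² · ∼ x ≤ f ²
  square·∼≤f² = ≤-trans (·-monoʳ (square-increasing _))
    (≤-trans (≤-reflexive ·-interchange) (·-mono x·∼x≤f x·∼x≤f))

  -- Dually to (x ∧ ¬x)² ≤ x·¬x ≤ f.
  e≤x∨∼x : ∀ {x} → e ≤ x ∨ ∼ x
  e≤x∨∼x {x} =
    ≤-resp (∼-involutive e) (trans ∼-∧ (trans (D.∨-comm _ _) (D.∨-cong (∼-involutive x) refl)))
      (∼-antitone (≤-trans (square-increasing (x ∧ ∼ x))
                           (≤-trans (·-mono ∧-lb₁ ∧-lb₂) x·∼x≤f)))

  -- If f² ≤ f then x² ≤ x for all x, so A is idempotent.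
  e≤∼f²⇒idempotent : e ≤ ∼ (f ²) → Idempotent A
  e≤∼f²⇒idempotent e≤∼f² x =
    ≤-antisym (·∼≤f-elim (≤-trans square·∼≤f² f²≤f)) (square-increasing x)
    where
    f²≤f : f ² ≤ f
    f²≤f = ≤-resp (∼-involutive _) refl (∼-antitone e≤∼f²)

  -- For a ≤ e, the principal upset ↑a is a deductive filter (closure under ·
  -- uses a ≤ a²); its congruence is trivial only if e ≤ a.
  module Principal (a : Carrier) (a≤e : a ≤ e) where
    ↑a : Carrier → Set
    ↑a x = a ≤ x

    ↑a-isDeductiveFilter : IsDeductiveFilter A ↑a
    ↑a-isDeductiveFilter = record
      { up-closed = λ p q → ≤-trans q p
      ; ∧-closed  = ∧-glb
      ; e∈G       = a≤e
      ; ·-closed  = λ p q → ≤-trans (square-increasing a) (·-mono p q)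
      }

    open FilterQuotient A isIRL ↑a ↑a-isDeductiveFilter public
      using (θ; θ-isCongruence)

    -- e θ (e ∧ a) since a ≤ e → (e ∧ a) and a ≤ (e ∧ a) → e; so a trivial θ
    -- gives e ≈ e ∧ a ≤ a.
    θ-trivial⇒e≤a : IsIdentity A θ → e ≤ a
    θ-trivial⇒e≤a trivial = ≤-trans (≤-reflexive (trivial e (e ∧ a) (a≤e⇒e∧a , a≤e∧a⇒e))) ∧-lb₂
      where
      a≤e⇒e∧a : a ≤ (e ⇒ (e ∧ a))
      a≤e⇒e∧a = curry (≤-trans (≤-reflexive (identityʳ a)) (∧-glb a≤e ≤-refl))
      a≤e∧a⇒e : a ≤ ((e ∧ a) ⇒ e)
      a≤e∧a⇒e = curry (≤-trans (·-mono a≤e ∧-lb₁) (≤-reflexive (identityˡ e)))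

  -- If e ≤ a ∨ b then the principal congruences of a and b meet in the identity:
  -- a, b ≤ x → y gives e ≤ a ∨ b ≤ x → y, i.e. x ≤ y.
  principal-meet-trivial : ∀ a b (a≤e : a ≤ e) (b≤e : b ≤ e) → e ≤ a ∨ b →
    IsIdentity A (λ x y → Principal.θ a a≤e x y × Principal.θ b b≤e x y)
  principal-meet-trivial _ _ _ _ e≤a∨b x y ((a≤x⇒y , a≤y⇒x) , (b≤x⇒y , b≤y⇒x)) =
    ≤-antisym (e≤⇒-elim (≤-trans e≤a∨b (∨-lub a≤x⇒y b≤x⇒y)))
              (e≤⇒-elim (≤-trans e≤a∨b (∨-lub a≤y⇒x b≤y⇒x)))

  -- In a finitely subdirectly irreducible, non-idempotent De Morgan monoid,
  -- e ≤ f²: split e = (e ∧ f²) ∨ (e ∧ ¬f²); irreducibility makes one of the two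
  -- principal congruences trivial, and e ≤ e ∧ ¬f² would make A idempotent.
  fsi-non-idempotent⇒e≤f² : FinitelySubdirectlyIrreducible A → ¬ Idempotent A → e ≤ f ²
  fsi-non-idempotent⇒e≤f² fsi non-idempotent =
    [ (λ trivial → ≤-trans (Pa.θ-trivial⇒e≤a trivial) ∧-lb₂)
    , (λ trivial → ⊥-elim (non-idempotent
                     (e≤∼f²⇒idempotent (≤-trans (Pb.θ-trivial⇒e≤a trivial) ∧-lb₂))))
    ]′ (fsi Pa.θ Pb.θ Pa.θ-isCongruence Pb.θ-isCongruence
            (principal-meet-trivial a b ∧-lb₁ ∧-lb₁ e≤a∨b))
    where
    a b : Carrier
    a = e ∧ f ²
    b = e ∧ ∼ (f ²)
    module Pa = Principal a ∧-lb₁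
    module Pb = Principal b ∧-lb₁
    e≤a∨b : e ≤ a ∨ b
    e≤a∨b = ≤-trans (∧-glb ≤-refl e≤x∨∼x) (≤-reflexive (D.∧-distribˡ-∨ e (f ²) (∼ (f ²))))

quotient-isDeMorganMonoid : (A : Ops) → IsDeMorganMonoid A → (G : Ops.Carrier A → Set) →
  IsDeductiveFilter A G → IsDeMorganMonoid (A / G)
quotient-isDeMorganMonoid A dm G filter = record
  { isIRL                 = quotient-isIRL
  ; isDistributiveLattice = quotient-isDistributiveLattice isDistributiveLattice
  ; square-increasing     = λ x → ≤/-intro (≤⇒G (square-increasing x))
  }
  where
  open IsDeMorganMonoid dm
  open FilterQuotient A isIRL G filter

-- ¬(f²) ∈ G makes A/G idempotent: x²·¬x ≤ f² means ¬(f²) ≤ x² → x.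
quotient-idempotent : (A : Ops) → IsDeMorganMonoid A → (G : Ops.Carrier A → Set) →
  IsDeductiveFilter A G → G (Ops.∼ A (Ops._² A (Ops.f A))) → Idempotent (A / G)
quotient-idempotent A dm G filter ¬f²∈G x =
  up-closed (∼-antitone square·∼≤f²) ¬f²∈G , ≤⇒G (square-increasing x)
  where
  open IsDeMorganMonoid dm
  open IRLProperties A isIRL
  open DeMorganProperties A dm
  open IsDeductiveFilter filter
  open FilterQuotient A isIRL G filter

-- If e ≤ f² and ¬(f²) ∈ G then f ≡ e in A/G: here f → e = ¬(f²),
-- and e → f ≈ f ≥ ¬(f²).
quotient-odd : (A : Ops) → IsIRL A → (G : Ops.Carrier A → Set) → IsDeductiveFilter A G →
  Ops._≤_ A (Ops.e A) (Ops._² A (Ops.f A)) → G (Ops.∼ A (Ops._² A (Ops.f A))) → IsOdd (A / G)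
quotient-odd A irl G filter e≤f² ¬f²∈G =
  ¬f²∈G , G-resp f≈e⇒f (up-closed (∼-antitone e≤f²) ¬f²∈G)
  where
  open Ops A
  open IsIRL irl
  open IsCommutativeMonoid ·-isCommutativeMonoid using (isEquivalence; identityˡ)
  open IsEquivalence isEquivalence
  open IRLProperties A irl
  open IsDeductiveFilter filter
  open FilterQuotient A irl G filter
  f≈e⇒f : f ≈ (e ⇒ f)
  f≈e⇒f = sym (trans (∼-cong (identityˡ _)) (∼-involutive _))

theorem5p12 : (A : Ops) → IsDeMorganMonoid A → FinitelySubdirectlyIrreducible A →
    ¬ Idempotent A → (G : Ops.Carrier A → Set) → IsDeductiveFilter A G →
    G (Ops.∼ A (Ops._² A (Ops.f A))) → IsOddSugiharaMonoid (A / G)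
theorem5p12 A dm fsi non-idempotent G filter ¬f²∈G = record
  { isSugiharaMonoid = record
    { isDeMorganMonoid = quotient-isDeMorganMonoid A dm G filter
    ; idempotent       = quotient-idempotent A dm G filter ¬f²∈G
    }
  ; odd = quotient-odd A (IsDeMorganMonoid.isIRL dm) G filter e≤f² ¬f²∈G
  }
  where
  e≤f² : Ops._≤_ A (Ops.e A) (Ops._² A (Ops.f A))
  e≤f² = DeMorganProperties.fsi-non-idempotent⇒e≤f² A dm fsi non-idempotent
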